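{- Let $n,\Delta\in\mathbb{N}$ be such that $n\ge\Delta>10\sqrt{n}$. There exist $m\ge\frac{1}{8}\cdot\frac{n}{\Delta}\log\left(\frac{\Delta}{\sqrt{n}}\right)$ and a mapping $\psi:\{0,1\}^m\to\mathcal{I}_{\le n}$ such that $\frac{\|\psi(\mathbf{y})-\psi(\mathbf{z})\|_1}{\|\mathbf{y}-\mathbf{z}\|_1}\in\left[\frac{\Delta}{8m},\frac{\Delta}{2m}\right]$ for all distinct $\mathbf{y},\mathbf{z}\in\{0,1\}^m$.
   Context: $\log$ denotes logarithm base 2. An integer partition is an infinite sequence $\mathbf{p}=(p_1,p_2,\dots)$ of non-negative integers with $p_1\ge p_2\ge\cdots$ and finite size $\sum_i p_i$; $\mathcal{I}_{\le n}$ is the set of integer partitions of size at most $n$. $\|\cdot\|_1$ is the $\ell_1$ norm (sequences padded with zeros). -}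

module Defs where

open import Data.Nat using (ℕ; zero; suc; _+_; _*_; _^_; _≤_; _<_; _≥_; ∣_-_∣)
open import Data.Bool using (Bool; true; false)
open import Data.List using (List; []; _∷_)
open import Data.Nat.ListAction using (sum)
open import Data.List.Relation.Unary.Linked using (Linked)
open import Data.Vec using (Vec; []; _∷_)
open import Data.Product using (Σ; _×_)
open import Relation.Binary.PropositionalEquality using (_≡_)

-- An integer partition: the infinite sequence (p₁,p₂,…) is represented by a
-- finite list of its first entries, the remaining entries being 0.
-- It must be non-increasing (p₁ ≥ p₂ ≥ …). Trailing zeros in the list are allowed.
IsPartition : List ℕ → Set
IsPartition p = Linked _≥_ p

size : List ℕ → ℕ
size = sum

Partition≤ : ℕ → Set
Partition≤ n = Σ (List ℕ) (λ p → IsPartition p × size p ≤ n)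

dist₁ : List ℕ → List ℕ → ℕ
dist₁ []       []       = 0
dist₁ []       (y ∷ ys) = y + dist₁ [] ys
dist₁ (x ∷ xs) []       = x + dist₁ xs []
dist₁ (x ∷ xs) (y ∷ ys) = ∣ x - y ∣ + dist₁ xs ys

bit : Bool → ℕ
bit false = 0
bit true  = 1

hamming : ∀ {m} → Vec Bool m → Vec Bool m → ℕ
hamming []       []       = 0
hamming (x ∷ xs) (y ∷ ys) = ∣ bit x - bit y ∣ + hamming xs ys

{-# OPTIONS --safe #-}
-- Fix a list of blocks (rectangles hᵢ × wᵢ, all of the same area k) and, for
-- y ∈ {0,1}^m, let ψ(y) be the Young diagram in which block i contributes hᵢ
-- rows of length  wᵢ yᵢ + (total width of the later blocks).  These rows are
-- non-increasing, and flipping yᵢ changes exactly hᵢ rows by wᵢ each, so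
-- ‖ψ(y) − ψ(z)‖₁ = k ‖y − z‖₁: ψ is a scaled isometry and its distortion is
-- decided by k alone.  To get many coordinates within size n we stack T + 1
-- levels of r blocks each, heights 1, 2, 4, … and widths 2^T s, 2^(T−1) s, …,
-- with r ≈ n/Δ, 4^T ≈ Δ/r ≈ Δ²/n and s chosen so that 4 m k ≈ Δ.  Then
-- m = (T + 1) r ≳ (n/Δ) log(Δ²/n).
module Submission where

open import Defs
open import Data.Nat
open import Data.Nat.Properties
open import Data.Nat.DivMod using (_/_; _%_; m≡m%n+[m/n]*n; m%n<n; m/n*n≤m; m≥n⇒m/n>0)
open import Data.Nat.Tactic.RingSolver using (solve-∀)
open import Data.Nat.ListAction using (sum)
open import Data.Nat.ListAction.Properties using (sum-++)
open import Data.Bool using (Bool; true; false)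
open import Data.List using (List; []; _∷_; _++_; replicate; length)
open import Data.List.Properties using (length-++; length-replicate)
open import Data.List.Relation.Unary.All using (All; []; _∷_)
open import Data.List.Relation.Unary.All.Properties using (++⁺; replicate⁺)
open import Data.List.Relation.Unary.Linked using (Linked; []; [-]; _∷_; tail)
open import Data.Vec using (Vec; []; _∷_)
open import Data.Product using (Σ; ∃; _×_; _,_; proj₁; map₂)
open import Data.Empty using (⊥-elim)
open import Relation.Binary.PropositionalEquality using (_≡_; refl; sym; trans; cong; cong₂; subst)
open import Relation.Nullary using (¬_; yes; no)
open ≤-Reasoning

-- Staircase partitions

Block : Set
Block = ℕ × ℕ

width : List Block → ℕ
width []             = 0
width ((_ , w) ∷ bs) = w + width bs

area : List Block → ℕ
area []             = 0
area ((h , w) ∷ bs) = h * (w + width bs) + area bs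

HasArea : ℕ → Block → Set
HasArea k (h , w) = h * w ≡ k

data HookBounded (c : ℕ) : List Block → Set where
  []  : HookBounded c []
  _∷_ : ∀ {h w bs} → h * (w + width bs) ≤ c → HookBounded c bs →
        HookBounded c ((h , w) ∷ bs)

staircase : (bs : List Block) → Vec Bool (length bs) → List ℕ
staircase []             []       = []
staircase ((h , w) ∷ bs) (x ∷ xs) = replicate h (width bs + w * bit x) ++ staircase bs xs

dist₁-replicate-++ : ∀ h a b xs ys →
  dist₁ (replicate h a ++ xs) (replicate h b ++ ys) ≡ h * ∣ a - b ∣ + dist₁ xs ys
dist₁-replicate-++ zero    a b xs ys = refl
dist₁-replicate-++ (suc h) a b xs ys =
  trans (cong (∣ a - b ∣ +_) (dist₁-replicate-++ h a b xs ys)) (sym (+-assoc ∣ a - b ∣ _ _))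

dist₁-staircase : ∀ {k} bs → All (HasArea k) bs → (y z : Vec Bool (length bs)) →
  dist₁ (staircase bs y) (staircase bs z) ≡ k * hamming y z
dist₁-staircase {k} [] [] [] [] = sym (*-zeroʳ k)
dist₁-staircase {k} ((h , w) ∷ bs) (hw≡k ∷ areas) (x ∷ y) (x′ ∷ z) = begin-equality
  dist₁ (replicate h (width bs + w * bit x) ++ staircase bs y)
        (replicate h (width bs + w * bit x′) ++ staircase bs z)
    ≡⟨ dist₁-replicate-++ h _ _ (staircase bs y) (staircase bs z) ⟩
  h * ∣ width bs + w * bit x - width bs + w * bit x′ ∣ + dist₁ (staircase bs y) (staircase bs z)
    ≡⟨ cong₂ (λ d e → h * d + e) (∣m+n-m+o∣≡∣n-o∣ (width bs) _ _)
             (dist₁-staircase bs areas y z) ⟩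
  h * ∣ w * bit x - w * bit x′ ∣ + k * hamming y z
    ≡⟨ cong (λ d → h * d + k * hamming y z) (sym (*-distribˡ-∣-∣ w (bit x) (bit x′))) ⟩
  h * (w * ∣ bit x - bit x′ ∣) + k * hamming y z
    ≡⟨ cong (_+ k * hamming y z) (trans (sym (*-assoc h w _)) (cong (_* ∣ bit x - bit x′ ∣) hw≡k)) ⟩
  k * ∣ bit x - bit x′ ∣ + k * hamming y z
    ≡⟨ sym (*-distribˡ-+ k _ _) ⟩
  k * hamming (x ∷ y) (x′ ∷ z) ∎

sum-replicate : ∀ h a → sum (replicate h a) ≡ h * a
sum-replicate zero    a = refl
sum-replicate (suc h) a = cong (a +_) (sum-replicate h a)

bit≤1 : ∀ x → bit x ≤ 1
bit≤1 false = z≤n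
bit≤1 true  = ≤-refl

row≤width : ∀ v w x → v + w * bit x ≤ w + v
row≤width v w x = begin
  v + w * bit x ≤⟨ +-monoʳ-≤ v (≤-trans (*-monoʳ-≤ w (bit≤1 x)) (≤-reflexive (*-identityʳ w))) ⟩
  v + w         ≡⟨ +-comm v w ⟩
  w + v         ∎

size-staircase≤area : ∀ bs (y : Vec Bool (length bs)) → size (staircase bs y) ≤ area bs
size-staircase≤area []             []      = ≤-refl
size-staircase≤area ((h , w) ∷ bs) (x ∷ y) = begin
  sum (replicate h (width bs + w * bit x) ++ staircase bs y)
    ≡⟨ sum-++ (replicate h _) (staircase bs y) ⟩
  sum (replicate h (width bs + w * bit x)) + sum (staircase bs y)
    ≡⟨ cong (_+ sum (staircase bs y)) (sum-replicate h _) ⟩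
  h * (width bs + w * bit x) + sum (staircase bs y)
    ≤⟨ +-mono-≤ (*-monoʳ-≤ h (row≤width (width bs) w x)) (size-staircase≤area bs y) ⟩
  h * (w + width bs) + area bs ∎

area≤length*hook : ∀ {c} bs → HookBounded c bs → area bs ≤ length bs * c
area≤length*hook []             []           = z≤n
area≤length*hook ((h , w) ∷ bs) (hook ∷ hbs) = +-mono-≤ hook (area≤length*hook bs hbs)

linked-≥-weakenHead : ∀ {a b ys} → b ≤ a → Linked _≥_ (b ∷ ys) → Linked _≥_ (a ∷ ys)
linked-≥-weakenHead b≤a [-]       = [-]
linked-≥-weakenHead b≤a (y≤b ∷ l) = ≤-trans y≤b b≤a ∷ l

linked-≥-replicate-++ : ∀ {a v b ys} h → v ≤ a → b ≤ v →
  Linked _≥_ (b ∷ ys) → Linked _≥_ (a ∷ replicate h v ++ ys)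
linked-≥-replicate-++ zero    v≤a b≤v l = linked-≥-weakenHead (≤-trans b≤v v≤a) l
linked-≥-replicate-++ (suc h) v≤a b≤v l = v≤a ∷ linked-≥-replicate-++ h ≤-refl b≤v l

staircase-linked : ∀ bs (y : Vec Bool (length bs)) → Linked _≥_ (width bs ∷ staircase bs y)
staircase-linked []             []      = [-]
staircase-linked ((h , w) ∷ bs) (x ∷ y) =
  linked-≥-replicate-++ h (row≤width (width bs) w x) (m≤m+n (width bs) _) (staircase-linked bs y)

staircase-isPartition : ∀ bs (y : Vec Bool (length bs)) → IsPartition (staircase bs y)
staircase-isPartition bs y = tail (staircase-linked bs y)

distortion-bounds : ∀ {Δ m k d h} → 4 * (m * k) ≤ Δ → Δ ≤ 8 * (m * k) → d ≡ k * h →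
  (Δ * h ≤ 8 * m * d) × (2 * m * d ≤ Δ * h)
distortion-bounds {Δ} {m} {k} {d} {h} 4mk≤Δ Δ≤8mk refl = lower , upper
  where
  lower : Δ * h ≤ 8 * m * (k * h)
  lower = begin
    Δ * h             ≤⟨ *-monoˡ-≤ h Δ≤8mk ⟩
    8 * (m * k) * h   ≡⟨ reassoc m k h ⟩
    8 * m * (k * h)   ∎
    where
    reassoc : ∀ m k h → 8 * (m * k) * h ≡ 8 * m * (k * h)
    reassoc = solve-∀
  upper : 2 * m * (k * h) ≤ Δ * h
  upper = begin
    2 * m * (k * h)   ≡⟨ reassoc m k h ⟩
    2 * (m * k) * h   ≤⟨ *-monoˡ-≤ h (*-monoˡ-≤ (m * k) (m≤m+n 2 2)) ⟩
    4 * (m * k) * h   ≤⟨ *-monoˡ-≤ h 4mk≤Δ ⟩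
    Δ * h             ∎
    where
    reassoc : ∀ m k h → 2 * m * (k * h) ≡ 2 * (m * k) * h
    reassoc = solve-∀

staircase-embedding : ∀ {n Δ k c} bs → All (HasArea k) bs → HookBounded c bs → length bs * c ≤ n →
  4 * (length bs * k) ≤ Δ → Δ ≤ 8 * (length bs * k) →
  Σ (Vec Bool (length bs) → Partition≤ n) λ ψ → (y z : Vec Bool (length bs)) →
    (Δ * hamming y z ≤ 8 * length bs * dist₁ (proj₁ (ψ y)) (proj₁ (ψ z)))
    × (2 * length bs * dist₁ (proj₁ (ψ y)) (proj₁ (ψ z)) ≤ Δ * hamming y z)
staircase-embedding {n} bs areas hooks area≤n 4mk≤Δ Δ≤8mk =
  (λ y → staircase bs y , staircase-isPartition bs y , size≤n y) ,
  λ y z → distortion-bounds {m = length bs} 4mk≤Δ Δ≤8mk (dist₁-staircase bs areas y z)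
  where
  size≤n : (y : Vec Bool (length bs)) → size (staircase bs y) ≤ n
  size≤n y = ≤-trans (size-staircase≤area bs y) (≤-trans (area≤length*hook bs hooks) area≤n)

-- The geometric ladder

ladder : (r s h d : ℕ) → List Block
ladder r s h zero    = []
ladder r s h (suc d) = replicate r (h , 2 ^ d * s) ++ ladder r s (2 * h) d

length-ladder : ∀ r s h d → length (ladder r s h d) ≡ d * r
length-ladder r s h zero    = refl
length-ladder r s h (suc d) =
  trans (length-++ (replicate r _)) (cong₂ _+_ (length-replicate r) (length-ladder r s (2 * h) d))

width-replicate-++ : ∀ q h w bs → width (replicate q (h , w) ++ bs) ≡ q * w + width bs
width-replicate-++ zero    h w bs = refl
width-replicate-++ (suc q) h w bs =
  trans (cong (w +_) (width-replicate-++ q h w bs)) (sym (+-assoc w (q * w) _))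

width-ladder : ∀ r s h d → width (ladder r s h d) + r * s ≡ r * (2 ^ d * s)
width-ladder r s h zero    = cong (r *_) (sym (*-identityˡ s))
width-ladder r s h (suc d) = begin-equality
  width (replicate r (h , 2 ^ d * s) ++ ladder r s (2 * h) d) + r * s
    ≡⟨ cong (_+ r * s) (width-replicate-++ r h _ (ladder r s (2 * h) d)) ⟩
  r * (2 ^ d * s) + width (ladder r s (2 * h) d) + r * s
    ≡⟨ +-assoc (r * (2 ^ d * s)) _ _ ⟩
  r * (2 ^ d * s) + (width (ladder r s (2 * h) d) + r * s)
    ≡⟨ cong (r * (2 ^ d * s) +_) (width-ladder r s (2 * h) d) ⟩
  r * (2 ^ d * s) + r * (2 ^ d * s)
    ≡⟨ double≡ r (2 ^ d) s ⟩
  r * (2 ^ suc d * s) ∎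
  where
  double≡ : ∀ r p s → r * (p * s) + r * (p * s) ≡ r * (2 * p * s)
  double≡ = solve-∀

ladder-areas : ∀ r s h d → All (HasArea (h * (2 ^ d * s))) (ladder r s h (suc d))
ladder-areas r s h zero    = ++⁺ (replicate⁺ r refl) []
ladder-areas r s h (suc d) =
  ++⁺ (replicate⁺ r refl)
      (subst (λ k → All (HasArea k) (ladder r s (2 * h) (suc d))) (halving≡ h (2 ^ d) s)
             (ladder-areas r s (2 * h) d))
  where
  halving≡ : ∀ h p s → 2 * h * (p * s) ≡ h * (2 * p * s)
  halving≡ = solve-∀

hookBounded-replicate-++ : ∀ {c h w bs} q → h * (q * w + width bs) ≤ c →
  HookBounded c bs → HookBounded c (replicate q (h , w) ++ bs)
hookBounded-replicate-++ zero    hook hbs = hbs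
hookBounded-replicate-++ {c} {h} {w} {bs} (suc q) hook hbs =
  hook′ ∷ hookBounded-replicate-++ q
            (≤-trans (*-monoʳ-≤ h (+-monoˡ-≤ (width bs) (m≤n+m (q * w) w))) hook) hbs
  where
  hook′ : h * (w + width (replicate q (h , w) ++ bs)) ≤ c
  hook′ = begin
    h * (w + width (replicate q (h , w) ++ bs)) ≡⟨ cong (λ t → h * (w + t)) (width-replicate-++ q h w bs) ⟩
    h * (w + (q * w + width bs))                 ≡⟨ cong (h *_) (sym (+-assoc w (q * w) (width bs))) ⟩
    h * (suc q * w + width bs)                   ≤⟨ hook ⟩
    c                                            ∎

ladder-hookBounded : ∀ r s h d → HookBounded (2 * r * (h * (2 ^ d * s))) (ladder r s h (suc d))
ladder-hookBounded r s h d = hookBounded-replicate-++ r top-hook (lower-levels d)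
  where
  k : ℕ
  k = 2 ^ d * s
  top-hook : h * (r * k + width (ladder r s (2 * h) d)) ≤ 2 * r * (h * k)
  top-hook = begin
    h * (r * k + width (ladder r s (2 * h) d))
      ≤⟨ *-monoʳ-≤ h (+-monoʳ-≤ (r * k)
           (≤-trans (m≤m+n _ (r * s)) (≤-reflexive (width-ladder r s (2 * h) d)))) ⟩
    h * (r * k + r * k) ≡⟨ doubled≡ h r k ⟩
    2 * r * (h * k)     ∎
    where
    doubled≡ : ∀ h r k → h * (r * k + r * k) ≡ 2 * r * (h * k)
    doubled≡ = solve-∀
  lower-levels : ∀ d → HookBounded (2 * r * (h * (2 ^ d * s))) (ladder r s (2 * h) d)
  lower-levels zero    = []
  lower-levels (suc d) =
    subst (λ c → HookBounded c (ladder r s (2 * h) (suc d))) (halving≡ r h (2 ^ d) s)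
          (ladder-hookBounded r s (2 * h) d)
    where
    halving≡ : ∀ r h p s → 2 * r * (2 * h * (p * s)) ≡ 2 * r * (h * (2 * p * s))
    halving≡ = solve-∀

-- Choice of the parameters

m<[1+m/n]*n : ∀ m n .{{_ : NonZero n}} → m < suc (m / n) * n
m<[1+m/n]*n m n = begin-strict
  m                 ≡⟨ m≡m%n+[m/n]*n m n ⟩
  m % n + m / n * n <⟨ +-monoˡ-< (m / n * n) (m%n<n m n) ⟩
  n + m / n * n     ∎

m<[1+o]*n⇒m≤2*[o*n] : ∀ {m n o} → 1 ≤ o → m < suc o * n → m ≤ 2 * (o * n)
m<[1+o]*n⇒m≤2*[o*n] {m} {n} {o} o≥1 m<[1+o]n = <⇒≤ (begin-strict
  m               <⟨ m<[1+o]n ⟩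
  n + o * n       ≤⟨ +-monoˡ-≤ (o * n) (≤-trans (≤-reflexive (sym (*-identityˡ n)))
                                               (*-monoˡ-≤ n o≥1)) ⟩
  o * n + o * n   ≡⟨ cong (o * n +_) (sym (+-identityʳ (o * n))) ⟩
  2 * (o * n)     ∎)

n<2^n : ∀ n → n < 2 ^ n
n<2^n zero    = s≤s z≤n
n<2^n (suc n) = begin-strict
  suc n         ≤⟨ n<2^n n ⟩
  2 ^ n         <⟨ m<m+n (2 ^ n) (m^n>0 2 n) ⟩
  2 ^ n + 2 ^ n ≡⟨ cong (2 ^ n +_) (sym (+-identityʳ (2 ^ n))) ⟩
  2 ^ suc n     ∎

^-distribʳ-* : ∀ m n o → (m * n) ^ o ≡ m ^ o * n ^ o
^-distribʳ-* m n zero    = refl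
^-distribʳ-* m n (suc o) = trans (cong (m * n *_) (^-distribʳ-* m n o)) (interchange m n (m ^ o) (n ^ o))
  where
  interchange : ∀ m n p q → m * n * (p * q) ≡ m * p * (n * q)
  interchange = solve-∀

power-bracket : ∀ b a D → 1 < b → 1 ≤ a → a ≤ D → ∃ λ T → a * b ^ T ≤ D × D < a * b ^ suc T
power-bracket b a (suc D) 1<b 1≤a@(s≤s z≤n) a≤1+D with a ≤? D
... | no a≰D = 0 , ≤-trans (≤-reflexive (*-identityʳ a)) a≤1+D , (begin-strict
  suc D     ≤⟨ ≰⇒> a≰D ⟩
  a         <⟨ m<m*n a b 1<b ⟩
  a * b     ≡⟨ cong (a *_) (sym (*-identityʳ b)) ⟩
  a * b ^ 1 ∎)
... | yes a≤D with power-bracket b a D 1<b 1≤a a≤D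
...   | T , lo , hi with suc D <? a * b ^ suc T
...     | yes hi′ = T , m≤n⇒m≤1+n lo , hi′
...     | no ¬hi′ = suc T , ≮⇒≥ ¬hi′ , (begin-strict
  suc D               ≤⟨ hi ⟩
  a * b ^ suc T       <⟨ m<m*n (a * b ^ suc T) b {{>-nonZero (≤-trans (s≤s z≤n) hi)}} 1<b ⟩
  a * b ^ suc T * b   ≡⟨ shift a b (b ^ T) ⟩
  a * b ^ suc (suc T) ∎)
  where
  shift : ∀ a b p → a * (b * p) * b ≡ a * (b * (b * p))
  shift = solve-∀

scale-bracket : ∀ u D → 1 ≤ u → 4 * u ≤ D → ∃ λ s → 4 * (u * s) ≤ D × D ≤ 8 * (u * s)
scale-bracket u@(suc _) D _ 4u≤D = s , lo , hi
  where
  s : ℕ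
  s = D / (4 * u)
  reassoc : ∀ u s → s * (4 * u) ≡ 4 * (u * s)
  reassoc = solve-∀
  lo : 4 * (u * s) ≤ D
  lo = subst (_≤ D) (reassoc u s) (m/n*n≤m D (4 * u))
  hi : D ≤ 8 * (u * s)
  hi = ≤-trans (m<[1+o]*n⇒m≤2*[o*n] (m≥n⇒m/n>0 4u≤D) (m<[1+m/n]*n D (4 * u)))
               (≤-reflexive (doubled u s))
    where
    doubled : ∀ u s → 2 * (s * (4 * u)) ≡ 8 * (u * s)
    doubled = solve-∀

m*n≤o⇒100*o<n*n⇒4*m≤n : ∀ {m n o} → m * n ≤ o → 100 * o < n * n → 4 * m ≤ n
m*n≤o⇒100*o<n*n⇒4*m≤n {m} {n} {o} mn≤o 100o<nn =
  ≤-trans (*-monoˡ-≤ m (m≤m+n 4 96)) (<⇒≤ (*-cancelʳ-< n (100 * m) n (begin-strict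
    100 * m * n   ≡⟨ *-assoc 100 m n ⟩
    100 * (m * n) ≤⟨ *-monoʳ-≤ 100 mn≤o ⟩
    100 * o       <⟨ 100o<nn ⟩
    n * n         ∎)))

ladder-unit≤ : ∀ r T → suc T * r * 2 ^ T ≤ r * 4 ^ T
ladder-unit≤ r T = begin
  suc T * r * 2 ^ T   ≤⟨ *-monoˡ-≤ (2 ^ T) (*-monoˡ-≤ r (n<2^n T)) ⟩
  2 ^ T * r * 2 ^ T   ≡⟨ regroup r (2 ^ T) ⟩
  r * (2 ^ T * 2 ^ T) ≡⟨ cong (r *_) (sym (^-distribʳ-* 2 2 T)) ⟩
  r * 4 ^ T           ∎
  where
  regroup : ∀ r p → p * r * p ≡ r * (p * p)
  regroup = solve-∀

level-square-bound : ∀ {n Δ} r T → r * Δ ≤ n → Δ < 4 * r * 4 ^ suc T → Δ * Δ ≤ 2 ^ (2 * T + 4) * n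
level-square-bound {n} {Δ} r T rΔ≤n Δ<4r4^[1+T] = begin
  Δ * Δ                   ≤⟨ *-monoʳ-≤ Δ (<⇒≤ Δ<4r4^[1+T]) ⟩
  Δ * (4 * r * 4 ^ suc T) ≡⟨ regroup Δ r (4 ^ T) ⟩
  4 ^ T * 16 * (r * Δ)    ≤⟨ *-monoʳ-≤ (4 ^ T * 16) rΔ≤n ⟩
  4 ^ T * 16 * n          ≡⟨ cong (_* n) (sym 2^[2T+4]≡4^T*16) ⟩
  2 ^ (2 * T + 4) * n     ∎
  where
  regroup : ∀ Δ r p → Δ * (4 * r * (4 * p)) ≡ p * 16 * (r * Δ)
  regroup = solve-∀
  2^[2T+4]≡4^T*16 : 2 ^ (2 * T + 4) ≡ 4 ^ T * 16
  2^[2T+4]≡4^T*16 = trans (^-distribˡ-+-* 2 (2 * T) 4) (cong (_* 16) (sym (^-*-assoc 2 2 T)))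

^-square-bound : ∀ {n Δ e E} → Δ * Δ ≤ 2 ^ e * n → e * n ≤ E → Δ ^ (2 * n) ≤ 2 ^ E * n ^ n
^-square-bound {n} {Δ} {e} {E} ΔΔ≤2^e*n en≤E = begin
  Δ ^ (2 * n)         ≡⟨ sym (^-*-assoc Δ 2 n) ⟩
  (Δ * (Δ * 1)) ^ n   ≡⟨ cong (λ t → (Δ * t) ^ n) (*-identityʳ Δ) ⟩
  (Δ * Δ) ^ n         ≤⟨ ^-monoˡ-≤ n ΔΔ≤2^e*n ⟩
  (2 ^ e * n) ^ n     ≡⟨ ^-distribʳ-* (2 ^ e) n n ⟩
  (2 ^ e) ^ n * n ^ n ≡⟨ cong (_* n ^ n) (^-*-assoc 2 e n) ⟩
  2 ^ (e * n) * n ^ n ≤⟨ *-monoˡ-≤ (n ^ n) (^-monoʳ-≤ 2 en≤E) ⟩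
  2 ^ E * n ^ n       ∎

ladder-dimension-bound : ∀ {n Δ} r T → r * Δ ≤ n → n ≤ 2 * (r * Δ) → Δ < 4 * r * 4 ^ suc T →
  Δ ^ (2 * n) ≤ 2 ^ (16 * (suc T * r) * Δ) * n ^ n
ladder-dimension-bound {n} {Δ} r T rΔ≤n n≤2rΔ Δ<4r4^[1+T] =
  ^-square-bound {n} {Δ} {2 * T + 4} (level-square-bound r T rΔ≤n Δ<4r4^[1+T]) (begin
    (2 * T + 4) * n                                      ≤⟨ *-monoʳ-≤ (2 * T + 4) n≤2rΔ ⟩
    (2 * T + 4) * (2 * (r * Δ))                          ≤⟨ m≤m+n _ ((12 * T + 8) * (r * Δ)) ⟩
    (2 * T + 4) * (2 * (r * Δ)) + (12 * T + 8) * (r * Δ) ≡⟨ expand T r Δ ⟩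
    16 * (suc T * r) * Δ                                 ∎)
  where
  expand : ∀ T r Δ → (2 * T + 4) * (2 * (r * Δ)) + (12 * T + 8) * (r * Δ) ≡ 16 * (suc T * r) * Δ
  expand = solve-∀

PartitionEmbedding : ℕ → ℕ → Set
PartitionEmbedding n Δ = Σ ℕ (λ m → (Δ ^ (2 * n) ≤ 2 ^ (16 * m * Δ) * n ^ n)
  × Σ (Vec Bool m → Partition≤ n) (λ ψ →
      (y z : Vec Bool m) → ¬ (y ≡ z) →
        (Δ * hamming y z ≤ 8 * m * dist₁ (proj₁ (ψ y)) (proj₁ (ψ z)))
        × (2 * m * dist₁ (proj₁ (ψ y)) (proj₁ (ψ z)) ≤ Δ * hamming y z)))

ladder-embedding : ∀ {n Δ} r T s → r * Δ ≤ n → n ≤ 2 * (r * Δ) → Δ < 4 * r * 4 ^ suc T →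
  4 * (suc T * r * 2 ^ T * s) ≤ Δ → Δ ≤ 8 * (suc T * r * 2 ^ T * s) → PartitionEmbedding n Δ
ladder-embedding {n} {Δ} r T s rΔ≤n n≤2rΔ levels-hi scale-lo scale-hi =
  length blocks ,
  subst (λ m → Δ ^ (2 * n) ≤ 2 ^ (16 * m * Δ) * n ^ n) (sym length≡)
        (ladder-dimension-bound r T rΔ≤n n≤2rΔ levels-hi) ,
  map₂ (λ distortion y z _ → distortion y z)
       (staircase-embedding blocks (ladder-areas r s 1 T) (ladder-hookBounded r s 1 T) area≤n 4mk≤Δ Δ≤8mk)
  where
  blocks : List Block
  blocks = ladder r s 1 (suc T)
  k : ℕ
  k = 1 * (2 ^ T * s)
  length≡ : length blocks ≡ suc T * r
  length≡ = length-ladder r s 1 (suc T)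
  mk≡ : suc T * r * 2 ^ T * s ≡ length blocks * k
  mk≡ = trans (regroup (suc T * r) (2 ^ T) s) (cong (_* k) (sym length≡))
    where
    regroup : ∀ m p s → m * p * s ≡ m * (1 * (p * s))
    regroup = solve-∀
  4mk≤Δ : 4 * (length blocks * k) ≤ Δ
  4mk≤Δ = subst (λ x → 4 * x ≤ Δ) mk≡ scale-lo
  Δ≤8mk : Δ ≤ 8 * (length blocks * k)
  Δ≤8mk = subst (λ x → Δ ≤ 8 * x) mk≡ scale-hi
  area≤n : length blocks * (2 * r * k) ≤ n
  area≤n = begin
    length blocks * (2 * r * k)   ≡⟨ regroup (length blocks) r k ⟩
    r * (2 * (length blocks * k)) ≤⟨ *-monoʳ-≤ r (*-monoˡ-≤ (length blocks * k) (m≤m+n 2 2)) ⟩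
    r * (4 * (length blocks * k)) ≤⟨ *-monoʳ-≤ r 4mk≤Δ ⟩
    r * Δ                         ≤⟨ rΔ≤n ⟩
    n                             ∎
    where
    regroup : ∀ m r k → m * (2 * r * k) ≡ r * (2 * (m * k))
    regroup = solve-∀

lemma2 : (n Δ : ℕ) → Δ ≤ n → 100 * n < Δ * Δ →
    Σ ℕ (λ m → (Δ ^ (2 * n) ≤ 2 ^ (16 * m * Δ) * n ^ n)
      × Σ (Vec Bool m → Partition≤ n) (λ ψ →
          (y z : Vec Bool m) → ¬ (y ≡ z) →
            (Δ * hamming y z ≤ 8 * m * dist₁ (proj₁ (ψ y)) (proj₁ (ψ z)))
            × (2 * m * dist₁ (proj₁ (ψ y)) (proj₁ (ψ z)) ≤ Δ * hamming y z)))
lemma2 n zero      _   100n<0  = ⊥-elim (n≮0 100n<0)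
lemma2 n Δ@(suc _) Δ≤n 100n<ΔΔ =
  let r : ℕ
      r = n / Δ
      r≥1 : 1 ≤ r
      r≥1 = m≥n⇒m/n>0 Δ≤n
      rΔ≤n : r * Δ ≤ n
      rΔ≤n = m/n*n≤m n Δ
      (T , levels-lo , levels-hi) =
        power-bracket 4 (4 * r) Δ (s≤s (s≤s z≤n)) (≤-trans r≥1 (m≤n*m r 4))
                      (m*n≤o⇒100*o<n*n⇒4*m≤n {r} rΔ≤n 100n<ΔΔ)
      unit≥1 : 1 ≤ suc T * r * 2 ^ T
      unit≥1 = *-mono-≤ (*-mono-≤ (s≤s (z≤n {T})) r≥1) (m^n>0 2 T)
      4unit≤Δ : 4 * (suc T * r * 2 ^ T) ≤ Δ
      4unit≤Δ = ≤-trans (*-monoʳ-≤ 4 (ladder-unit≤ r T))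
                        (≤-trans (≤-reflexive (sym (*-assoc 4 r (4 ^ T)))) levels-lo)
      (s , scale-lo , scale-hi) = scale-bracket (suc T * r * 2 ^ T) Δ unit≥1 4unit≤Δ
  in ladder-embedding r T s rΔ≤n (m<[1+o]*n⇒m≤2*[o*n] r≥1 (m<[1+m/n]*n n Δ)) levels-hi scale-lo scale-hi
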